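{- Let $G$ be a simple graph with $n$ vertices and $m$ edges. Let $h(G)$ be the number of $3$-element subsets $S\subseteq V(G)$ such that the induced subgraph $G[S]$ has exactly one edge (i.e. the number of induced copies in $G$ of the graph on three vertices with one edge). Then the number of triangles in $G$ is at least $$\frac{h(G)}{3}+\frac{4m}{3n}\left(m-\frac{n^2}{4}\right).$$
   Context: A graph is simple if it has no loops or parallel edges. A triangle is a set of three pairwise adjacent vertices. -}

module Defs where

open import Data.Bool using (Bool; true; false; T)
open import Data.Nat using (ℕ; zero; suc; _+_; _<_; _<ᵇ_)
open import Data.Fin using (Fin; toℕ)
open import Data.List using (List; length; filter; allFin)
open import Data.List using (concatMap)
open import Data.Product using (_×_; _,_)
open import Relation.Binary.PropositionalEquality using (_≡_)
open import Relation.Nullary using (¬_)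
open import Relation.Nullary.Decidable using (Dec; yes; no)

record SimpleGraph (n : ℕ) : Set where
  field
    adj     : Fin n → Fin n → Bool
    symm    : ∀ i j → adj i j ≡ adj j i
    irrefl  : ∀ i → adj i i ≡ false
open SimpleGraph public

count3 : Bool → Bool → Bool → ℕ
count3 a b c = b2n a + b2n b + b2n c
  where
  b2n : Bool → ℕ
  b2n true = 1
  b2n false = 0

pairs : (n : ℕ) → List (Fin n × Fin n)
pairs n = concatMap (λ i → concatMap (λ j → pair? i j) (allFin n)) (allFin n)
  where
  pair? : Fin n → Fin n → List (Fin n × Fin n)
  pair? i j with toℕ i <ᵇ toℕ j
  ... | true  = (i , j) Data.List.∷ Data.List.[]
  ... | false = Data.List.[]

triples : (n : ℕ) → List (Fin n × Fin n × Fin n)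
triples n = concatMap (λ i → concatMap (λ j → concatMap (λ k → trip? i j k) (allFin n)) (allFin n)) (allFin n)
  where
  trip? : Fin n → Fin n → Fin n → List (Fin n × Fin n × Fin n)
  trip? i j k with toℕ i <ᵇ toℕ j | toℕ j <ᵇ toℕ k
  ... | true | true = (i , j , k) Data.List.∷ Data.List.[]
  ... | _    | _    = Data.List.[]

edgesIn : ∀ {n} → SimpleGraph n → Fin n × Fin n × Fin n → ℕ
edgesIn G (i , j , k) = count3 (adj G i j) (adj G i k) (adj G j k)

isEdge : ∀ {n} → SimpleGraph n → Fin n × Fin n → Bool
isEdge G (i , j) = adj G i j

eqℕ : ℕ → ℕ → Bool
eqℕ zero zero = true
eqℕ (suc a) (suc b) = eqℕ a b
eqℕ _ _ = false

edgeCount : ∀ {n} → SimpleGraph n → ℕ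
edgeCount {n} G = length (filter (λ p → Data.Bool._≟_ (isEdge G p) true) (pairs n))

triangleCount : ∀ {n} → SimpleGraph n → ℕ
triangleCount {n} G = length (filter (λ t → Data.Bool._≟_ (eqℕ (edgesIn G t) 3) true) (triples n))

hCount : ∀ {n} → SimpleGraph n → ℕ
hCount {n} G = length (filter (λ t → Data.Bool._≟_ (eqℕ (edgesIn G t) 1) true) (triples n))

module Submission where

-- For a 3-set S spanning e edges, 3·[e = 3] + e = [e = 1] + 2·(e choose 2). Summed over all S,
-- each edge lies in n - 2 triples and each cherry (two edges at a common vertex v) in one, and
-- there are Σ_v d(v) (d(v) - 1) / 2 cherries; hence 3 T + n m = h + Σ_v d(v)². Cauchy–Schwarz
-- with Σ_v d(v) = 2 m gives n Σ_v d(v)² ≥ 4 m², so 3 T ≥ h + 4 m² / n - n m.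

open import Defs
open import Data.Nat using (ℕ; suc)

module FiniteSums where

  open import Data.Nat using (zero; _+_; _*_; _≤_; z≤n)
  open import Data.Nat.Properties
    using ( +-*-semiring; +-commutativeSemigroup; +-comm; *-comm; *-zeroʳ; *-distribˡ-+
          ; ≤-reflexive; ≤-trans; ≤-total; m≤m+n; m≤n⇒∃[o]m+o≡n; +-mono-≤; +-monoˡ-≤; module ≤-Reasoning )
  open import Data.Nat.Tactic.RingSolver using (solve-∀)
  open import Data.Fin using (Fin; zero; suc)
  open import Data.Product using (_,_)
  open import Data.Sum using ([_,_]′)
  open import Function using (_∘_)
  open import Relation.Binary.PropositionalEquality
  open import Algebra.Properties.Semiring.Sum +-*-semiring public
    using (sum; sum-cong-≗; ∑-distrib-+; *-distribˡ-sum; sum-replicate-zero)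
  open import Algebra.Properties.CommutativeSemigroup +-commutativeSemigroup using (interchange)

  sumSquares : ∀ {n} → (Fin n → ℕ) → ℕ
  sumSquares x = sum (λ i → x i * x i)

  sum-const : ∀ n c → sum {n} (λ _ → c) ≡ n * c
  sum-const zero    c = refl
  sum-const (suc n) c = cong (c +_) (sum-const n c)

  sum-mono-≤ : ∀ {n} {f g : Fin n → ℕ} → (∀ i → f i ≤ g i) → sum f ≤ sum g
  sum-mono-≤ {zero}  f≤g = z≤n
  sum-mono-≤ {suc n} f≤g = +-mono-≤ (f≤g zero) (sum-mono-≤ (f≤g ∘ suc))

  pairSum : ∀ {n} → (Fin n → Fin n → ℕ) → ℕ
  pairSum {zero}  f = 0
  pairSum {suc n} f = sum (f zero ∘ suc) + pairSum (λ j k → f (suc j) (suc k))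

  tripleSum : ∀ {n} → (Fin n → Fin n → Fin n → ℕ) → ℕ
  tripleSum {zero}  f = 0
  tripleSum {suc n} f = pairSum (λ j k → f zero (suc j) (suc k)) + tripleSum (λ i j k → f (suc i) (suc j) (suc k))

  pairSum-cong : ∀ {n} {f g : Fin n → Fin n → ℕ} → (∀ i j → f i j ≡ g i j) → pairSum f ≡ pairSum g
  pairSum-cong {zero}  f≗g = refl
  pairSum-cong {suc n} f≗g = cong₂ _+_ (sum-cong-≗ (f≗g zero ∘ suc)) (pairSum-cong λ j k → f≗g (suc j) (suc k))

  pairSum-distrib-+ : ∀ {n} (f g : Fin n → Fin n → ℕ) → pairSum (λ i j → f i j + g i j) ≡ pairSum f + pairSum g
  pairSum-distrib-+ {zero}  f g = refl
  pairSum-distrib-+ {suc n} f g =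
    trans (cong₂ _+_ (∑-distrib-+ (f zero ∘ suc) (g zero ∘ suc)) (pairSum-distrib-+ f′ g′))
          (interchange (sum (f zero ∘ suc)) (sum (g zero ∘ suc)) (pairSum f′) (pairSum g′))
    where
    f′ g′ : Fin n → Fin n → ℕ
    f′ j k = f (suc j) (suc k)
    g′ j k = g (suc j) (suc k)

  *-distribˡ-pairSum : ∀ {n} c (f : Fin n → Fin n → ℕ) → c * pairSum f ≡ pairSum (λ i j → c * f i j)
  *-distribˡ-pairSum {zero}  c f = *-zeroʳ c
  *-distribˡ-pairSum {suc n} c f = trans (*-distribˡ-+ c _ _)
    (cong₂ _+_ (*-distribˡ-sum c (f zero ∘ suc)) (*-distribˡ-pairSum c (λ j k → f (suc j) (suc k))))

  pairSum-mono-≤ : ∀ {n} {f g : Fin n → Fin n → ℕ} → (∀ i j → f i j ≤ g i j) → pairSum f ≤ pairSum g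
  pairSum-mono-≤ {zero}  f≤g = z≤n
  pairSum-mono-≤ {suc n} f≤g = +-mono-≤ (sum-mono-≤ (f≤g zero ∘ suc)) (pairSum-mono-≤ λ j k → f≤g (suc j) (suc k))

  tripleSum-cong : ∀ {n} {f g : Fin n → Fin n → Fin n → ℕ} → (∀ i j k → f i j k ≡ g i j k) → tripleSum f ≡ tripleSum g
  tripleSum-cong {zero}  f≗g = refl
  tripleSum-cong {suc n} f≗g =
    cong₂ _+_ (pairSum-cong (λ j k → f≗g zero (suc j) (suc k))) (tripleSum-cong λ i j k → f≗g (suc i) (suc j) (suc k))

  tripleSum-distrib-+ : ∀ {n} (f g : Fin n → Fin n → Fin n → ℕ) →
    tripleSum (λ i j k → f i j k + g i j k) ≡ tripleSum f + tripleSum g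
  tripleSum-distrib-+ {zero}  f g = refl
  tripleSum-distrib-+ {suc n} f g =
    trans (cong₂ _+_ (pairSum-distrib-+ f₀ g₀) (tripleSum-distrib-+ f′ g′))
          (interchange (pairSum f₀) (pairSum g₀) (tripleSum f′) (tripleSum g′))
    where
    f₀ g₀ : Fin n → Fin n → ℕ
    f₀ j k = f zero (suc j) (suc k)
    g₀ j k = g zero (suc j) (suc k)
    f′ g′ : Fin n → Fin n → Fin n → ℕ
    f′ i j k = f (suc i) (suc j) (suc k)
    g′ i j k = g (suc i) (suc j) (suc k)

  *-distribˡ-tripleSum : ∀ {n} c (f : Fin n → Fin n → Fin n → ℕ) → c * tripleSum f ≡ tripleSum (λ i j k → c * f i j k)
  *-distribˡ-tripleSum {zero}  c f = *-zeroʳ c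
  *-distribˡ-tripleSum {suc n} c f = trans (*-distribˡ-+ c _ _)
    (cong₂ _+_ (*-distribˡ-pairSum c (λ j k → f zero (suc j) (suc k))) (*-distribˡ-tripleSum c (λ i j k → f (suc i) (suc j) (suc k))))

  -- Each index lies in n - 1 of the pairs.
  pairSum-endpoints : ∀ n (x : Fin n → ℕ) → pairSum (λ j k → x j + x k) + sum x ≡ n * sum x
  pairSum-endpoints zero    x = refl
  pairSum-endpoints (suc n) x = begin
    sum (λ k → x₀ + xs k) + P + (x₀ + Σxs)
      ≡⟨ cong (λ s → s + P + (x₀ + Σxs)) (trans (∑-distrib-+ (λ _ → x₀) xs) (cong (_+ Σxs) (sum-const n x₀))) ⟩
    n * x₀ + Σxs + P + (x₀ + Σxs)  ≡⟨ regroup (n * x₀) Σxs P x₀ ⟩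
    x₀ + Σxs + n * x₀ + (P + Σxs)  ≡⟨ cong (x₀ + Σxs + n * x₀ +_) (pairSum-endpoints n xs) ⟩
    x₀ + Σxs + n * x₀ + n * Σxs    ≡⟨ factor n x₀ Σxs ⟩
    suc n * (x₀ + Σxs)             ∎
    where
    open ≡-Reasoning
    x₀ = x zero
    xs = x ∘ suc
    Σxs = sum xs
    P = pairSum (λ j k → xs j + xs k)
    regroup : ∀ a s p b → a + s + p + (b + s) ≡ b + s + a + (p + s)
    regroup = solve-∀
    factor : ∀ n a s → a + s + n * a + n * s ≡ suc n * (a + s)
    factor = solve-∀

  square-of-sum : ∀ n (x : Fin n → ℕ) → sum x * sum x ≡ 2 * pairSum (λ j k → x j * x k) + sumSquares x
  square-of-sum zero    x = refl
  square-of-sum (suc n) x = begin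
    (x₀ + Σxs) * (x₀ + Σxs)
      ≡⟨ expand x₀ Σxs ⟩
    2 * (x₀ * Σxs) + x₀ * x₀ + Σxs * Σxs
      ≡⟨ cong₂ (λ a b → 2 * a + x₀ * x₀ + b) (*-distribˡ-sum x₀ xs) (square-of-sum n xs) ⟩
    2 * sum (λ k → x₀ * xs k) + x₀ * x₀ + (2 * P + Q)
      ≡⟨ regroup (sum (λ k → x₀ * xs k)) (x₀ * x₀) P Q ⟩
    2 * (sum (λ k → x₀ * xs k) + P) + (x₀ * x₀ + Q) ∎
    where
    open ≡-Reasoning
    x₀ = x zero
    xs = x ∘ suc
    Σxs = sum xs
    P = pairSum (λ j k → xs j * xs k)
    Q = sumSquares xs
    expand : ∀ a s → (a + s) * (a + s) ≡ 2 * (a * s) + a * a + s * s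
    expand = solve-∀
    regroup : ∀ r a p q → 2 * r + a + (2 * p + q) ≡ 2 * (r + p) + (a + q)
    regroup = solve-∀

  2ab≤a²+b² : ∀ a b → 2 * (a * b) ≤ a * a + b * b
  2ab≤a²+b² a b = [ ordered , swapped ]′ (≤-total a b)
    where
    ordered : ∀ {a b} → a ≤ b → 2 * (a * b) ≤ a * a + b * b
    ordered {a} a≤b with m≤n⇒∃[o]m+o≡n a≤b
    ... | k , refl = ≤-trans (m≤m+n _ (k * k)) (≤-reflexive (gap a k))
      where
      gap : ∀ a k → 2 * (a * (a + k)) + k * k ≡ a * a + (a + k) * (a + k)
      gap = solve-∀
    swapped : b ≤ a → 2 * (a * b) ≤ a * a + b * b
    swapped b≤a = subst₂ _≤_ (cong (2 *_) (*-comm b a)) (+-comm (b * b) (a * a)) (ordered b≤a)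

  cauchy-schwarz : ∀ n (x : Fin n → ℕ) → sum x * sum x ≤ n * sumSquares x
  cauchy-schwarz n x = begin
    sum x * sum x                               ≡⟨ square-of-sum n x ⟩
    2 * pairSum (λ j k → x j * x k) + Q         ≡⟨ cong (_+ Q) (*-distribˡ-pairSum 2 (λ j k → x j * x k)) ⟩
    pairSum (λ j k → 2 * (x j * x k)) + Q       ≤⟨ +-monoˡ-≤ Q (pairSum-mono-≤ λ j k → 2ab≤a²+b² (x j) (x k)) ⟩
    pairSum (λ j k → x j * x j + x k * x k) + Q ≡⟨ pairSum-endpoints n (λ i → x i * x i) ⟩
    n * Q                                       ∎
    where
    open ≤-Reasoning
    Q = sumSquares x

module AdjacencyMatrices where

  open import Data.Nat using (zero; _+_; _*_)
  open import Data.Nat.Properties using (*-distribˡ-+)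
  open import Data.Nat.Tactic.RingSolver using (solve-∀)
  open import Data.Fin using (Fin; zero; suc)
  open import Function using (_∘_)
  open import Relation.Binary.PropositionalEquality
  open FiniteSums

  Matrix : ℕ → Set
  Matrix n = Fin n → Fin n → ℕ

  record IsMultigraph {n} (a : Matrix n) : Set where
    field
      symmetric    : ∀ i j → a i j ≡ a j i
      zeroDiagonal : ∀ i → a i i ≡ 0

  record IsSimpleGraph {n} (a : Matrix n) : Set where
    field
      isMultigraph : IsMultigraph a
      zeroOne      : ∀ i j → a i j * a i j ≡ a i j
    open IsMultigraph isMultigraph public

  degree : ∀ {n} → Matrix n → Fin n → ℕ
  degree a i = sum (a i)

  edgesOf : ∀ {n} → Matrix n → Fin n → Fin n → Fin n → ℕ
  edgesOf a i j k = a i j + a i k + a j k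

  cherriesOf : ∀ {n} → Matrix n → Fin n → Fin n → Fin n → ℕ
  cherriesOf a i j k = a i j * a i k + a i j * a j k + a i k * a j k

  tail : ∀ {n} → Matrix (suc n) → Matrix n
  tail a j k = a (suc j) (suc k)

  firstRow : ∀ {n} → Matrix (suc n) → Fin n → ℕ
  firstRow a = a zero ∘ suc

  tail-isMultigraph : ∀ {n} {a : Matrix (suc n)} → IsMultigraph a → IsMultigraph (tail a)
  tail-isMultigraph mg = record
    { symmetric = λ i j → symmetric (suc i) (suc j) ; zeroDiagonal = zeroDiagonal ∘ suc }
    where open IsMultigraph mg

  tail-isSimpleGraph : ∀ {n} {a : Matrix (suc n)} → IsSimpleGraph a → IsSimpleGraph (tail a)
  tail-isSimpleGraph sg = record
    { isMultigraph = tail-isMultigraph isMultigraph ; zeroOne = λ i j → zeroOne (suc i) (suc j) }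
    where open IsSimpleGraph sg

  degree-suc : ∀ {n} {a : Matrix (suc n)} → IsMultigraph a → ∀ j → degree a (suc j) ≡ firstRow a j + degree (tail a) j
  degree-suc {a = a} mg j = cong (_+ degree (tail a) j) (IsMultigraph.symmetric mg (suc j) zero)

  degree-zero : ∀ {n} {a : Matrix (suc n)} → IsMultigraph a → degree a zero ≡ sum (firstRow a)
  degree-zero {a = a} mg = cong (_+ sum (firstRow a)) (IsMultigraph.zeroDiagonal mg zero)

  handshake : ∀ n (a : Matrix n) → IsMultigraph a → sum (degree a) ≡ 2 * pairSum a
  handshake zero    a mg = refl
  handshake (suc n) a mg = begin
    degree a zero + sum (degree a ∘ suc)            ≡⟨ cong₂ _+_ (degree-zero mg) (sum-cong-≗ (degree-suc mg)) ⟩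
    d + sum (λ j → firstRow a j + degree a′ j)       ≡⟨ cong (d +_) (∑-distrib-+ (firstRow a) (degree a′)) ⟩
    d + (d + sum (degree a′))                        ≡⟨ cong (λ s → d + (d + s)) (handshake n a′ (tail-isMultigraph mg)) ⟩
    d + (d + 2 * pairSum a′)                         ≡⟨ double d (pairSum a′) ⟩
    2 * (d + pairSum a′)                             ∎
    where
    open ≡-Reasoning
    a′ = tail a
    d = sum (firstRow a)
    double : ∀ d p → d + (d + 2 * p) ≡ 2 * (d + p)
    double = solve-∀

  -- Each pair lies in n - 2 of the triples.
  tripleSum-edges : ∀ n (a : Matrix n) → tripleSum (edgesOf a) + 2 * pairSum a ≡ n * pairSum a
  tripleSum-edges zero    a = refl
  tripleSum-edges (suc n) a = begin
    pairSum (λ j k → x j + x k + a′ j k) + E + 2 * (d + m)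
      ≡⟨ cong (λ p → p + E + 2 * (d + m)) (pairSum-distrib-+ (λ j k → x j + x k) a′) ⟩
    X + m + E + 2 * (d + m)        ≡⟨ regroup X m E d ⟩
    (X + d) + (E + 2 * m) + (d + m) ≡⟨ cong₂ (λ p q → p + q + (d + m)) (pairSum-endpoints n x) (tripleSum-edges n a′) ⟩
    n * d + n * m + (d + m)        ≡⟨ factor n d m ⟩
    suc n * (d + m)                ∎
    where
    open ≡-Reasoning
    x = firstRow a
    a′ = tail a
    d = sum x
    m = pairSum a′
    E = tripleSum (edgesOf a′)
    X = pairSum (λ j k → x j + x k)
    regroup : ∀ X m E d → X + m + E + 2 * (d + m) ≡ (X + d) + (E + 2 * m) + (d + m)
    regroup = solve-∀
    factor : ∀ n d m → n * d + n * m + (d + m) ≡ suc n * (d + m)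
    factor = solve-∀

  pairSum-weighted-degree : ∀ n (x : Fin n → ℕ) (a : Matrix n) → IsMultigraph a →
    pairSum (λ j k → x j * a j k) + pairSum (λ j k → x k * a j k) ≡ sum (λ j → x j * degree a j)
  pairSum-weighted-degree zero    x a mg = refl
  pairSum-weighted-degree (suc n) x a mg = begin
    (sum (λ k → x₀ * r k) + P) + (Y + Q)
      ≡⟨ cong (λ s → (s + P) + (Y + Q)) (*-distribˡ-sum x₀ r) ⟨
    (x₀ * sum r + P) + (Y + Q)
      ≡⟨ regroup (x₀ * sum r) P Y Q ⟩
    x₀ * sum r + (Y + (P + Q))
      ≡⟨ cong (λ s → x₀ * sum r + (Y + s)) (pairSum-weighted-degree n xs a′ (tail-isMultigraph mg)) ⟩
    x₀ * sum r + (Y + Z)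
      ≡⟨ cong₂ (λ d s → x₀ * d + s) (degree-zero mg) (∑-distrib-+ (λ k → xs k * r k) (λ j → xs j * degree a′ j)) ⟨
    x₀ * degree a zero + sum (λ j → xs j * r j + xs j * degree a′ j)
      ≡⟨ cong (x₀ * degree a zero +_) (sum-cong-≗ λ j → *-distribˡ-+ (xs j) (r j) (degree a′ j)) ⟨
    x₀ * degree a zero + sum (λ j → xs j * (r j + degree a′ j))
      ≡⟨ cong (x₀ * degree a zero +_) (sum-cong-≗ λ j → cong (xs j *_) (degree-suc mg j)) ⟨
    x₀ * degree a zero + sum (λ j → xs j * degree a (suc j)) ∎
    where
    open ≡-Reasoning
    x₀ = x zero
    xs = x ∘ suc
    r = firstRow a
    a′ = tail a
    P = pairSum (λ j k → xs j * a′ j k)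
    Q = pairSum (λ j k → xs k * a′ j k)
    Y = sum (λ k → xs k * r k)
    Z = sum (λ j → xs j * degree a′ j)
    regroup : ∀ x p y q → (x + p) + (y + q) ≡ x + (y + (p + q))
    regroup = solve-∀

  sumSquares-degree-suc : ∀ {n} {a : Matrix (suc n)} → IsSimpleGraph a →
    sumSquares (degree a) ≡
      sum (firstRow a) * sum (firstRow a)
      + (sum (firstRow a) + 2 * sum (λ j → firstRow a j * degree (tail a) j) + sumSquares (degree (tail a)))
  sumSquares-degree-suc {a = a} sg = begin
    degree a zero * degree a zero + sum (λ j → degree a (suc j) * degree a (suc j))
      ≡⟨ cong₂ (λ e s → e * e + s) (degree-zero isMultigraph) (sum-cong-≗ λ j → cong (λ e → e * e) (degree-suc isMultigraph j)) ⟩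
    d * d + sum (λ j → (x j + δ j) * (x j + δ j))
      ≡⟨ cong (d * d +_) (sum-cong-≗ λ j → expand (x j) (δ j)) ⟩
    d * d + sum (λ j → x j * x j + 2 * (x j * δ j) + δ j * δ j)
      ≡⟨ cong (d * d +_) (trans (∑-distrib-+ (λ j → x j * x j + 2 * (x j * δ j)) (λ j → δ j * δ j))
                              (cong (_+ sumSquares δ) (∑-distrib-+ (λ j → x j * x j) (λ j → 2 * (x j * δ j))))) ⟩
    d * d + (sumSquares x + sum (λ j → 2 * (x j * δ j)) + sumSquares δ)
      ≡⟨ cong₂ (λ s t → d * d + (s + t + sumSquares δ))
               (sum-cong-≗ λ j → zeroOne zero (suc j)) (sym (*-distribˡ-sum 2 (λ j → x j * δ j))) ⟩
    d * d + (d + 2 * sum (λ j → x j * δ j) + sumSquares δ) ∎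
    where
    open ≡-Reasoning
    open IsSimpleGraph sg
    x = firstRow a
    δ = degree (tail a)
    d = sum x
    expand : ∀ a b → (a + b) * (a + b) ≡ a * a + 2 * (a * b) + b * b
    expand = solve-∀

  tripleSum-cherries : ∀ n (a : Matrix n) → IsSimpleGraph a →
    2 * tripleSum (cherriesOf a) + 2 * pairSum a ≡ sumSquares (degree a)
  tripleSum-cherries zero    a sg = refl
  tripleSum-cherries (suc n) a sg = begin
    2 * (pairSum (λ j k → x j * x k + x j * a′ j k + x k * a′ j k) + C) + 2 * (d + m)
      ≡⟨ cong (λ p → 2 * (p + C) + 2 * (d + m)) split ⟩
    2 * (Pxx + Pxa + Pxk + C) + 2 * (d + m)
      ≡⟨ regroup Pxx Pxa Pxk C d m ⟩
    (2 * Pxx + d) + (d + 2 * (Pxa + Pxk) + (2 * C + 2 * m))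
      ≡⟨ cong₂ (λ s t → s + (d + 2 * t + (2 * C + 2 * m))) square (pairSum-weighted-degree n x a′ (tail-isMultigraph isMultigraph)) ⟩
    d * d + (d + 2 * sum (λ j → x j * degree a′ j) + (2 * C + 2 * m))
      ≡⟨ cong (λ s → d * d + (d + 2 * sum (λ j → x j * degree a′ j) + s)) (tripleSum-cherries n a′ (tail-isSimpleGraph sg)) ⟩
    d * d + (d + 2 * sum (λ j → x j * degree a′ j) + sumSquares (degree a′))
      ≡⟨ sumSquares-degree-suc sg ⟨
    sumSquares (degree a) ∎
    where
    open ≡-Reasoning
    open IsSimpleGraph sg
    x = firstRow a
    a′ = tail a
    d = sum x
    m = pairSum a′
    C = tripleSum (cherriesOf a′)
    Pxx = pairSum (λ j k → x j * x k)
    Pxa = pairSum (λ j k → x j * a′ j k)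
    Pxk = pairSum (λ j k → x k * a′ j k)
    split : pairSum (λ j k → x j * x k + x j * a′ j k + x k * a′ j k) ≡ Pxx + Pxa + Pxk
    split = trans (pairSum-distrib-+ (λ j k → x j * x k + x j * a′ j k) (λ j k → x k * a′ j k))
                  (cong (_+ Pxk) (pairSum-distrib-+ (λ j k → x j * x k) (λ j k → x j * a′ j k)))
    square : 2 * Pxx + d ≡ d * d
    square = trans (cong (2 * Pxx +_) (sym (sum-cong-≗ λ j → zeroOne zero (suc j)))) (sym (square-of-sum n x))
    regroup : ∀ p q r c d m → 2 * (p + q + r + c) + 2 * (d + m) ≡ (2 * p + d) + (d + 2 * (q + r) + (2 * c + 2 * m))
    regroup = solve-∀

module Enumeration where

  open import Data.Bool using (Bool; true; false; if_then_else_; _∧_)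
  import Data.Bool as Bool
  open import Data.Bool.Properties using (∧-zeroʳ)
  open import Data.Nat using (zero; _+_; _<ᵇ_)
  open import Data.Fin using (Fin; zero; suc; toℕ)
  open import Data.List using (List; []; _∷_; _++_; length; filter; concatMap; tabulate; allFin)
  open import Data.List.Properties using (length-++; filter-++; concatMap-cong)
  open import Data.Product using (_×_; _,_)
  open import Function using (_∘_; id)
  open import Relation.Binary.PropositionalEquality
  open FiniteSums

  ⟦_⟧ : Bool → ℕ
  ⟦ true  ⟧ = 1
  ⟦ false ⟧ = 0

  count : ∀ {A : Set} → (A → Bool) → List A → ℕ
  count q xs = length (filter (λ x → q x Bool.≟ true) xs)

  count-concatMap : ∀ {A B : Set} (q : A → Bool) (f : B → List A) n (g : Fin n → B) →
    count q (concatMap f (tabulate g)) ≡ sum (λ i → count q (f (g i)))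
  count-concatMap q f zero    g = refl
  count-concatMap q f (suc n) g = begin
    length (filter P? (f (g zero) ++ concatMap f (tabulate (g ∘ suc))))
      ≡⟨ cong length (filter-++ P? (f (g zero)) _) ⟩
    length (filter P? (f (g zero)) ++ filter P? (concatMap f (tabulate (g ∘ suc))))
      ≡⟨ length-++ (filter P? (f (g zero))) ⟩
    count q (f (g zero)) + count q (concatMap f (tabulate (g ∘ suc)))
      ≡⟨ cong (count q (f (g zero)) +_) (count-concatMap q f n (g ∘ suc)) ⟩
    count q (f (g zero)) + sum (λ i → count q (f (g (suc i)))) ∎
    where
    open ≡-Reasoning
    P? = λ x → q x Bool.≟ true

  singletonIf : ∀ {A : Set} → Bool → A → List A
  singletonIf b x = if b then x ∷ [] else []

  count-singletonIf : ∀ {A : Set} (q : A → Bool) b x → count q (singletonIf b x) ≡ (if b then ⟦ q x ⟧ else 0)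
  count-singletonIf q false x = refl
  count-singletonIf q true  x with q x
  ... | true  = refl
  ... | false = refl

  orderedPair : ∀ {n} → Fin n → Fin n → List (Fin n × Fin n)
  orderedPair i j = singletonIf (toℕ i <ᵇ toℕ j) (i , j)

  orderedTriple : ∀ {n} → Fin n → Fin n → Fin n → List (Fin n × Fin n × Fin n)
  orderedTriple i j k = singletonIf ((toℕ i <ᵇ toℕ j) ∧ (toℕ j <ᵇ toℕ k)) (i , j , k)

  -- The entries of `pairs` and `triples` are built by helpers local to their definitions,
  -- which cannot be named here; the `_` below are solved from their uses in the unfoldings.
  mutual
    pairs-unfold : ∀ n → pairs n ≡ concatMap (λ i → concatMap (orderedPair i) (allFin n)) (allFin n)
    pairs-unfold n = concatMap-cong (λ i → concatMap-cong (pairs-entry n i) (allFin n)) (allFin n)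

    pairs-entry : ∀ n (i j : Fin n) → _ ≡ orderedPair i j
    pairs-entry n i j with toℕ i <ᵇ toℕ j
    ... | true  = refl
    ... | false = refl

  mutual
    triples-unfold : ∀ n → triples n ≡ concatMap (λ i → concatMap (λ j → concatMap (orderedTriple i j) (allFin n)) (allFin n)) (allFin n)
    triples-unfold n =
      concatMap-cong (λ i → concatMap-cong (λ j → concatMap-cong (triples-entry n i j) (allFin n)) (allFin n)) (allFin n)

    triples-entry : ∀ n (i j k : Fin n) → _ ≡ orderedTriple i j k
    triples-entry n i j k with toℕ i <ᵇ toℕ j | toℕ j <ᵇ toℕ k
    ... | true  | true  = refl
    ... | true  | false = refl
    ... | false | _     = refl

  ∑∑<≡pairSum : ∀ {n} (f : Fin n → Fin n → ℕ) →
    sum (λ i → sum (λ j → if toℕ i <ᵇ toℕ j then f i j else 0)) ≡ pairSum f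
  ∑∑<≡pairSum {zero}  f = refl
  ∑∑<≡pairSum {suc n} f = cong (sum (f zero ∘ suc) +_) (∑∑<≡pairSum (λ j k → f (suc j) (suc k)))

  if-∧-false : ∀ b (x : ℕ) → (if b ∧ false then x else 0) ≡ 0
  if-∧-false b x = cong (λ c → if c then x else 0) (∧-zeroʳ b)

  ∑∑∑<≡tripleSum : ∀ {n} (f : Fin n → Fin n → Fin n → ℕ) →
    sum (λ i → sum (λ j → sum (λ k → if (toℕ i <ᵇ toℕ j) ∧ (toℕ j <ᵇ toℕ k) then f i j k else 0))) ≡ tripleSum f
  ∑∑∑<≡tripleSum {zero}  f = refl
  ∑∑∑<≡tripleSum {suc n} f = cong₂ _+_ first rest
    where
    first : sum (λ j → sum (λ k → if (0 <ᵇ toℕ j) ∧ (toℕ j <ᵇ toℕ k) then f zero j k else 0))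
            ≡ pairSum (λ j k → f zero (suc j) (suc k))
    first = trans (cong (_+ sum (λ j → sum (λ k → if toℕ j <ᵇ toℕ k then f zero (suc j) (suc k) else 0)))
                        (sum-replicate-zero (suc n)))
                  (∑∑<≡pairSum (λ j k → f zero (suc j) (suc k)))
    shift : ∀ i → sum (λ j → sum (λ k → if (suc (toℕ i) <ᵇ toℕ j) ∧ (toℕ j <ᵇ toℕ k) then f (suc i) j k else 0))
                  ≡ sum (λ j → sum (λ k → if (toℕ i <ᵇ toℕ j) ∧ (toℕ j <ᵇ toℕ k) then f (suc i) (suc j) (suc k) else 0))
    shift i = trans (cong (_+ sum outer) (sum-replicate-zero (suc n)))
                    (sum-cong-≗ λ j → cong (_+ inner j) (if-∧-false (toℕ i <ᵇ toℕ j) (f (suc i) (suc j) zero)))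
      where
      outer inner : Fin n → ℕ
      outer j = sum (λ k → if (toℕ i <ᵇ toℕ j) ∧ (suc (toℕ j) <ᵇ toℕ k) then f (suc i) (suc j) k else 0)
      inner j = sum (λ k → if (toℕ i <ᵇ toℕ j) ∧ (toℕ j <ᵇ toℕ k) then f (suc i) (suc j) (suc k) else 0)
    rest : sum (λ i → sum (λ j → sum (λ k → if (suc (toℕ i) <ᵇ toℕ j) ∧ (toℕ j <ᵇ toℕ k) then f (suc i) j k else 0)))
           ≡ tripleSum (λ i j k → f (suc i) (suc j) (suc k))
    rest = trans (sum-cong-≗ shift) (∑∑∑<≡tripleSum (λ i j k → f (suc i) (suc j) (suc k)))

  count-pairs : ∀ n (q : Fin n × Fin n → Bool) → count q (pairs n) ≡ pairSum (λ i j → ⟦ q (i , j) ⟧)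
  count-pairs n q = begin
    count q (pairs n)
      ≡⟨ cong (count q) (pairs-unfold n) ⟩
    count q (concatMap (λ i → concatMap (orderedPair i) (allFin n)) (allFin n))
      ≡⟨ count-concatMap q (λ i → concatMap (orderedPair i) (allFin n)) n id ⟩
    sum (λ i → count q (concatMap (orderedPair i) (allFin n)))
      ≡⟨ sum-cong-≗ (λ i → count-concatMap q (orderedPair i) n id) ⟩
    sum (λ i → sum (λ j → count q (orderedPair i j)))
      ≡⟨ sum-cong-≗ (λ i → sum-cong-≗ λ j → count-singletonIf q (toℕ i <ᵇ toℕ j) (i , j)) ⟩
    sum (λ i → sum (λ j → if toℕ i <ᵇ toℕ j then ⟦ q (i , j) ⟧ else 0))
      ≡⟨ ∑∑<≡pairSum (λ i j → ⟦ q (i , j) ⟧) ⟩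
    pairSum (λ i j → ⟦ q (i , j) ⟧) ∎
    where open ≡-Reasoning

  count-triples : ∀ n (q : Fin n × Fin n × Fin n → Bool) → count q (triples n) ≡ tripleSum (λ i j k → ⟦ q (i , j , k) ⟧)
  count-triples n q = begin
    count q (triples n)
      ≡⟨ cong (count q) (triples-unfold n) ⟩
    count q (concatMap (λ i → concatMap (λ j → concatMap (orderedTriple i j) (allFin n)) (allFin n)) (allFin n))
      ≡⟨ count-concatMap q (λ i → concatMap (λ j → concatMap (orderedTriple i j) (allFin n)) (allFin n)) n id ⟩
    sum (λ i → count q (concatMap (λ j → concatMap (orderedTriple i j) (allFin n)) (allFin n)))
      ≡⟨ sum-cong-≗ (λ i → count-concatMap q (λ j → concatMap (orderedTriple i j) (allFin n)) n id) ⟩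
    sum (λ i → sum (λ j → count q (concatMap (orderedTriple i j) (allFin n))))
      ≡⟨ sum-cong-≗ (λ i → sum-cong-≗ λ j → count-concatMap q (orderedTriple i j) n id) ⟩
    sum (λ i → sum (λ j → sum (λ k → count q (orderedTriple i j k))))
      ≡⟨ sum-cong-≗ (λ i → sum-cong-≗ λ j → sum-cong-≗ λ k →
           count-singletonIf q ((toℕ i <ᵇ toℕ j) ∧ (toℕ j <ᵇ toℕ k)) (i , j , k)) ⟩
    sum (λ i → sum (λ j → sum (λ k → if (toℕ i <ᵇ toℕ j) ∧ (toℕ j <ᵇ toℕ k) then ⟦ q (i , j , k) ⟧ else 0)))
      ≡⟨ ∑∑∑<≡tripleSum (λ i j k → ⟦ q (i , j , k) ⟧) ⟩
    tripleSum (λ i j k → ⟦ q (i , j , k) ⟧) ∎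
    where open ≡-Reasoning

module Graph {n : ℕ} (G : SimpleGraph n) where

  open import Data.Bool using (true; false)
  open import Data.Nat using (_+_; _*_; _≤_)
  open import Data.Nat.Properties using (+-assoc; module ≤-Reasoning)
  open import Data.Nat.Tactic.RingSolver using (solve-∀)
  open import Data.Fin using (Fin)
  open import Data.Product using (_,_)
  open import Relation.Binary.PropositionalEquality
  open FiniteSums
  open AdjacencyMatrices
  open Enumeration

  A : Matrix n
  A i j = ⟦ adj G i j ⟧

  A-isSimpleGraph : IsSimpleGraph A
  A-isSimpleGraph = record
    { isMultigraph = record
      { symmetric    = λ i j → cong ⟦_⟧ (symm G i j)
      ; zeroDiagonal = λ i → cong ⟦_⟧ (irrefl G i) }
    ; zeroOne = λ i j → idempotent (adj G i j) }
    where
    idempotent : ∀ b → ⟦ b ⟧ * ⟦ b ⟧ ≡ ⟦ b ⟧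
    idempotent true  = refl
    idempotent false = refl

  edge-pattern : ∀ p q r →
    3 * ⟦ eqℕ (count3 p q r) 3 ⟧ + (⟦ p ⟧ + ⟦ q ⟧ + ⟦ r ⟧)
      ≡ ⟦ eqℕ (count3 p q r) 1 ⟧ + 2 * (⟦ p ⟧ * ⟦ q ⟧ + ⟦ p ⟧ * ⟦ r ⟧ + ⟦ q ⟧ * ⟦ r ⟧)
  edge-pattern true  true  true  = refl
  edge-pattern true  true  false = refl
  edge-pattern true  false true  = refl
  edge-pattern true  false false = refl
  edge-pattern false true  true  = refl
  edge-pattern false true  false = refl
  edge-pattern false false true  = refl
  edge-pattern false false false = refl

  spans : ℕ → Fin n → Fin n → Fin n → ℕ
  spans e i j k = ⟦ eqℕ (edgesIn G (i , j , k)) e ⟧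

  triangles-edges-cherries : 3 * triangleCount G + tripleSum (edgesOf A) ≡ hCount G + 2 * tripleSum (cherriesOf A)
  triangles-edges-cherries = begin
    3 * triangleCount G + tripleSum (edgesOf A)
      ≡⟨ cong (λ t → 3 * t + tripleSum (edgesOf A)) (count-triples n (λ t → eqℕ (edgesIn G t) 3)) ⟩
    3 * tripleSum (spans 3) + tripleSum (edgesOf A)
      ≡⟨ cong (_+ tripleSum (edgesOf A)) (*-distribˡ-tripleSum 3 (spans 3)) ⟩
    tripleSum (λ i j k → 3 * spans 3 i j k) + tripleSum (edgesOf A)
      ≡⟨ tripleSum-distrib-+ (λ i j k → 3 * spans 3 i j k) (edgesOf A) ⟨
    tripleSum (λ i j k → 3 * spans 3 i j k + edgesOf A i j k)
      ≡⟨ tripleSum-cong (λ i j k → edge-pattern (adj G i j) (adj G i k) (adj G j k)) ⟩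
    tripleSum (λ i j k → spans 1 i j k + 2 * cherriesOf A i j k)
      ≡⟨ tripleSum-distrib-+ (spans 1) (λ i j k → 2 * cherriesOf A i j k) ⟩
    tripleSum (spans 1) + tripleSum (λ i j k → 2 * cherriesOf A i j k)
      ≡⟨ cong₂ _+_ (count-triples n (λ t → eqℕ (edgesIn G t) 1)) (*-distribˡ-tripleSum 2 (cherriesOf A)) ⟨
    hCount G + 2 * tripleSum (cherriesOf A) ∎
    where open ≡-Reasoning

  degreeSquareSum : ℕ
  degreeSquareSum = sumSquares (degree A)

  edgeCount≡pairSum : edgeCount G ≡ pairSum A
  edgeCount≡pairSum = count-pairs n (isEdge G)

  degree-identity : 3 * triangleCount G + n * edgeCount G ≡ hCount G + degreeSquareSum
  degree-identity = begin
    3 * T + n * edgeCount G      ≡⟨ cong (λ m → 3 * T + n * m) edgeCount≡pairSum ⟩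
    3 * T + n * m                ≡⟨ cong (3 * T +_) (tripleSum-edges n A) ⟨
    3 * T + (E + 2 * m)          ≡⟨ +-assoc (3 * T) E (2 * m) ⟨
    3 * T + E + 2 * m            ≡⟨ cong (_+ 2 * m) triangles-edges-cherries ⟩
    hCount G + 2 * C + 2 * m     ≡⟨ +-assoc (hCount G) (2 * C) (2 * m) ⟩
    hCount G + (2 * C + 2 * m)   ≡⟨ cong (hCount G +_) (tripleSum-cherries n A A-isSimpleGraph) ⟩
    hCount G + sumSquares (degree A) ∎
    where
    open ≡-Reasoning
    T = triangleCount G
    m = pairSum A
    E = tripleSum (edgesOf A)
    C = tripleSum (cherriesOf A)

  edge-square-bound : 4 * (edgeCount G * edgeCount G) ≤ n * degreeSquareSum
  edge-square-bound = begin
    4 * (m * m)                    ≡⟨ double-square m ⟩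
    2 * m * (2 * m)                ≡⟨ cong (λ d → d * d) (trans (cong (2 *_) edgeCount≡pairSum) (sym (handshake n A isMultigraph))) ⟩
    sum (degree A) * sum (degree A) ≤⟨ cauchy-schwarz n (degree A) ⟩
    n * sumSquares (degree A)      ∎
    where
    open ≤-Reasoning
    open IsSimpleGraph A-isSimpleGraph using (isMultigraph)
    m = edgeCount G
    double-square : ∀ m → 4 * (m * m) ≡ 2 * m * (2 * m)
    double-square = solve-∀

module RationalBound where

  open import Data.Nat as ℕ using ()
  open import Data.Integer as ℤ using (ℤ; +_)
  open import Data.Integer.Properties as ℤ using (pos-*; pos-+)
  open import Data.Integer.Tactic.RingSolver using (solve-∀)
  open import Data.Rational using (_+_; _-_; _*_; _/_; _≤_; -_; toℚᵘ)
  open import Data.Rational.Properties using (toℚᵘ-fromℚᵘ; toℚᵘ-homo-+; toℚᵘ-homo-*; toℚᵘ-homo‿-; toℚᵘ-cancel-≤)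
  open import Data.Rational.Unnormalised as ℚᵘ using (ℚᵘ; mkℚᵘ; *≤*)
  open import Data.Rational.Unnormalised.Properties as ℚᵘ using (+-cong; *-cong; -‿cong; ≤-respˡ-≃; ≤-respʳ-≃)
  open import Relation.Binary.PropositionalEquality

  -- The cross-multiplied form of `boundᵘ N h m ≤ t`, i.e. 12 N h + 48 m² - 12 N² m ≤ 36 N t.
  cleared-bound : ∀ (H T M N S : ℤ) → + 3 ℤ.* T ℤ.+ N ℤ.* M ≡ H ℤ.+ S → + 4 ℤ.* (M ℤ.* M) ℤ.≤ N ℤ.* S →
    (H ℤ.* (+ 3 ℤ.* N ℤ.* + 4) ℤ.+ + 4 ℤ.* M ℤ.* (M ℤ.* + 4 ℤ.+ ℤ.- (N ℤ.* N) ℤ.* + 1) ℤ.* + 3) ℤ.* + 1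
      ℤ.≤ T ℤ.* (+ 3 ℤ.* (+ 3 ℤ.* N ℤ.* + 4))
  cleared-bound H T M N S eq ineq = begin
    (H ℤ.* (+ 3 ℤ.* N ℤ.* + 4) ℤ.+ + 4 ℤ.* M ℤ.* (M ℤ.* + 4 ℤ.+ ℤ.- (N ℤ.* N) ℤ.* + 1) ℤ.* + 3) ℤ.* + 1
      ≡⟨ expand H M N ⟩
    + 12 ℤ.* (N ℤ.* H ℤ.- N ℤ.* N ℤ.* M) ℤ.+ + 12 ℤ.* (+ 4 ℤ.* (M ℤ.* M))
      ≤⟨ ℤ.+-monoʳ-≤ (+ 12 ℤ.* (N ℤ.* H ℤ.- N ℤ.* N ℤ.* M)) (ℤ.*-monoˡ-≤-nonNeg (+ 12) ineq) ⟩
    + 12 ℤ.* (N ℤ.* H ℤ.- N ℤ.* N ℤ.* M) ℤ.+ + 12 ℤ.* (N ℤ.* S)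
      ≡⟨ collect H M N S ⟩
    + 12 ℤ.* N ℤ.* (H ℤ.+ S) ℤ.- + 12 ℤ.* N ℤ.* N ℤ.* M
      ≡⟨ cong (λ x → + 12 ℤ.* N ℤ.* x ℤ.- + 12 ℤ.* N ℤ.* N ℤ.* M) eq ⟨
    + 12 ℤ.* N ℤ.* (+ 3 ℤ.* T ℤ.+ N ℤ.* M) ℤ.- + 12 ℤ.* N ℤ.* N ℤ.* M
      ≡⟨ cancel T M N ⟩
    T ℤ.* (+ 3 ℤ.* (+ 3 ℤ.* N ℤ.* + 4)) ∎
    where
    open ℤ.≤-Reasoning
    expand : ∀ H M N → (H ℤ.* (+ 3 ℤ.* N ℤ.* + 4) ℤ.+ + 4 ℤ.* M ℤ.* (M ℤ.* + 4 ℤ.+ ℤ.- (N ℤ.* N) ℤ.* + 1) ℤ.* + 3) ℤ.* + 1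
      ≡ + 12 ℤ.* (N ℤ.* H ℤ.- N ℤ.* N ℤ.* M) ℤ.+ + 12 ℤ.* (+ 4 ℤ.* (M ℤ.* M))
    expand = solve-∀
    collect : ∀ H M N S → + 12 ℤ.* (N ℤ.* H ℤ.- N ℤ.* N ℤ.* M) ℤ.+ + 12 ℤ.* (N ℤ.* S)
      ≡ + 12 ℤ.* N ℤ.* (H ℤ.+ S) ℤ.- + 12 ℤ.* N ℤ.* N ℤ.* M
    collect = solve-∀
    cancel : ∀ T M N → + 12 ℤ.* N ℤ.* (+ 3 ℤ.* T ℤ.+ N ℤ.* M) ℤ.- + 12 ℤ.* N ℤ.* N ℤ.* M
      ≡ T ℤ.* (+ 3 ℤ.* (+ 3 ℤ.* N ℤ.* + 4))
    cancel = solve-∀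

  toℚᵘ-/ : ∀ i k → toℚᵘ (i / ℕ.suc k) ℚᵘ.≃ mkℚᵘ i k
  toℚᵘ-/ i k = toℚᵘ-fromℚᵘ (mkℚᵘ i k)

  boundᵘ : ℕ.ℕ → ℕ.ℕ → ℕ.ℕ → ℚᵘ
  boundᵘ N h m =
    mkℚᵘ (+ h) 2 ℚᵘ.+ mkℚᵘ (+ (4 ℕ.* m)) (ℕ.pred (3 ℕ.* N)) ℚᵘ.* (mkℚᵘ (+ m) 0 ℚᵘ.- mkℚᵘ (+ (N ℕ.* N)) 3)

  toℚᵘ-bound : ∀ n h m → toℚᵘ ((+ h) / 3 + (+ (4 ℕ.* m)) / (3 ℕ.* ℕ.suc n) * ((+ m) / 1 - (+ (ℕ.suc n ℕ.* ℕ.suc n)) / 4))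
    ℚᵘ.≃ boundᵘ (ℕ.suc n) h m
  toℚᵘ-bound n h m = begin
    toℚᵘ (a + b * (c - d))                     ≈⟨ toℚᵘ-homo-+ a (b * (c - d)) ⟩
    toℚᵘ a ℚᵘ.+ toℚᵘ (b * (c - d))             ≈⟨ +-cong (toℚᵘ-/ (+ h) 2) (toℚᵘ-homo-* b (c - d)) ⟩
    mkℚᵘ (+ h) 2 ℚᵘ.+ toℚᵘ b ℚᵘ.* toℚᵘ (c - d) ≈⟨ +-cong (ℚᵘ.≃-refl {mkℚᵘ (+ h) 2}) (*-cong b≃ c-d≃) ⟩
    boundᵘ (ℕ.suc n) h m                        ∎
    where
    open ℚᵘ.≃-Reasoning
    a = (+ h) / 3
    b = (+ (4 ℕ.* m)) / (3 ℕ.* ℕ.suc n)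
    c = (+ m) / 1
    d = (+ (ℕ.suc n ℕ.* ℕ.suc n)) / 4
    b≃ : toℚᵘ b ℚᵘ.≃ mkℚᵘ (+ (4 ℕ.* m)) (ℕ.pred (3 ℕ.* ℕ.suc n))
    b≃ = toℚᵘ-/ (+ (4 ℕ.* m)) (ℕ.pred (3 ℕ.* ℕ.suc n))
    c-d≃ : toℚᵘ (c - d) ℚᵘ.≃ mkℚᵘ (+ m) 0 ℚᵘ.- mkℚᵘ (+ (ℕ.suc n ℕ.* ℕ.suc n)) 3
    c-d≃ = ℚᵘ.≃-trans (toℚᵘ-homo-+ c (- d))
             (+-cong (toℚᵘ-/ (+ m) 0) (ℚᵘ.≃-trans (toℚᵘ-homo‿- d) (-‿cong (toℚᵘ-/ (+ (ℕ.suc n ℕ.* ℕ.suc n)) 3))))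

  boundᵘ-≤ : ∀ n h t m s → 3 ℕ.* t ℕ.+ ℕ.suc n ℕ.* m ≡ h ℕ.+ s → 4 ℕ.* (m ℕ.* m) ℕ.≤ ℕ.suc n ℕ.* s →
    boundᵘ (ℕ.suc n) h m ℚᵘ.≤ mkℚᵘ (+ t) 0
  boundᵘ-≤ n h t m s eq ineq = *≤* (subst₂ ℤ._≤_ lhs rhs (cleared-bound (+ h) (+ t) (+ m) (+ N) (+ s) eqℤ ineqℤ))
    where
    -- `+ (a ℕ.* b)` and `+ a ℤ.* + b` agree only propositionally (`pos-*`), hence `lhs` and `rhs`.
    N = ℕ.suc n
    12N : + (3 ℕ.* N ℕ.* 4) ≡ + 3 ℤ.* + N ℤ.* + 4
    12N = trans (pos-* (3 ℕ.* N) 4) (cong (ℤ._* + 4) (pos-* 3 N))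
    lhs : (+ h ℤ.* (+ 3 ℤ.* + N ℤ.* + 4) ℤ.+ + 4 ℤ.* + m ℤ.* (+ m ℤ.* + 4 ℤ.+ ℤ.- (+ N ℤ.* + N) ℤ.* + 1) ℤ.* + 3) ℤ.* + 1
        ≡ (+ h ℤ.* + (3 ℕ.* N ℕ.* 4) ℤ.+ + (4 ℕ.* m) ℤ.* (+ m ℤ.* + 4 ℤ.+ ℤ.- + (N ℕ.* N) ℤ.* + 1) ℤ.* + 3) ℤ.* + 1
    lhs = cong₂ (λ x y → (+ h ℤ.* x ℤ.+ y) ℤ.* + 1) (sym 12N)
            (cong₂ (λ x y → x ℤ.* (+ m ℤ.* + 4 ℤ.+ ℤ.- y ℤ.* + 1) ℤ.* + 3) (sym (pos-* 4 m)) (sym (pos-* N N)))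
    rhs : + t ℤ.* (+ 3 ℤ.* (+ 3 ℤ.* + N ℤ.* + 4)) ≡ + t ℤ.* + (3 ℕ.* (3 ℕ.* N ℕ.* 4))
    rhs = cong (+ t ℤ.*_) (sym (trans (pos-* 3 (3 ℕ.* N ℕ.* 4)) (cong (+ 3 ℤ.*_) 12N)))
    eqℤ : + 3 ℤ.* + t ℤ.+ + N ℤ.* + m ≡ + h ℤ.+ + s
    eqℤ = begin
      + 3 ℤ.* + t ℤ.+ + N ℤ.* + m ≡⟨ cong₂ ℤ._+_ (pos-* 3 t) (pos-* N m) ⟨
      + (3 ℕ.* t) ℤ.+ + (N ℕ.* m) ≡⟨ pos-+ (3 ℕ.* t) (N ℕ.* m) ⟨
      + (3 ℕ.* t ℕ.+ N ℕ.* m)     ≡⟨ cong +_ eq ⟩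
      + (h ℕ.+ s)                 ≡⟨ pos-+ h s ⟩
      + h ℤ.+ + s                 ∎
      where open ≡-Reasoning
    ineqℤ : + 4 ℤ.* (+ m ℤ.* + m) ℤ.≤ + N ℤ.* + s
    ineqℤ = subst₂ ℤ._≤_ (trans (pos-* 4 (m ℕ.* m)) (cong (+ 4 ℤ.*_) (pos-* m m))) (pos-* N s) (ℤ.+≤+ ineq)

  bound : ∀ n h t m s → 3 ℕ.* t ℕ.+ ℕ.suc n ℕ.* m ≡ h ℕ.+ s → 4 ℕ.* (m ℕ.* m) ℕ.≤ ℕ.suc n ℕ.* s →
    (+ h) / 3 + (+ (4 ℕ.* m)) / (3 ℕ.* ℕ.suc n) * ((+ m) / 1 - (+ (ℕ.suc n ℕ.* ℕ.suc n)) / 4) ≤ (+ t) / 1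
  bound n h t m s eq ineq = toℚᵘ-cancel-≤
    (≤-respʳ-≃ (ℚᵘ.≃-sym (toℚᵘ-/ (+ t) 0)) (≤-respˡ-≃ (ℚᵘ.≃-sym (toℚᵘ-bound n h m)) (boundᵘ-≤ n h t m s eq ineq)))

open import Data.Integer using (+_)
open import Data.Rational using (ℚ; _+_; _-_; _*_; _/_; _≤_)

theorem2p3 : (n : ℕ) → (G : SimpleGraph (suc n)) →
    ((+ hCount G) / 3 + ((+ (4 Data.Nat.* edgeCount G)) / (3 Data.Nat.* suc n))
        * ((+ edgeCount G) / 1 - (+ (suc n Data.Nat.* suc n)) / 4))
      ≤ (+ triangleCount G) / 1
theorem2p3 n G =
  RationalBound.bound n (hCount G) (triangleCount G) (edgeCount G) degreeSquareSum degree-identity edge-square-bound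
  where open Graph G
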